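{- Let $I=(n,m,X_1,\ldots,X_m,\tau)$ be an instance of WPPSG and let $\Pi_0,\Pi'_1,\Pi_1,\ldots,\Pi'_m,\Pi_m$ be the sets computed by the procedure REDUCE-EXPAND on input $X_1,\ldots,X_m$. Then $I$ is nice if and only if $\Pi_m\neq\emptyset$.
   Context: $\mathcal{S}_n$ is the symmetric group on $[n]=\{1,\ldots,n\}$, with $i\sigma$ the image of $i$ and products composed left to right; $X\sigma=\{i\sigma:i\in X\}$; $\mathcal{S}_X$ is the subgroup fixing every element outside $X$. REDUCE-EXPAND: set $X_0=[n]$, $\Pi_0=\mathcal{S}_n$; for $j=1,\ldots,m$: $\Pi'_j=\{\pi\sigma:\pi\in\Pi_{j-1},\ \sigma\in\mathcal{S}_{X_{j-1}\pi}\}$ and $\Pi_j=\{\pi\in\Pi'_j: X_j\pi\text{ is a set of consecutive integers}\}$. An instance of WPPSG is $I=(n,m,X_1,\ldots,X_m,\tau)$ with $X_j\subseteq[n]$, $\tau\in\mathcal{S}_n$; WPPSG$_0$ consists of instances in which every $X_j$ is a set of consecutive integers. For $\pi\in\mathcal{S}_n$, $I^\pi=(n,m,X_1\pi,\ldots,X_m\pi,\pi^{ -1}\tau\pi)$. For $j'\in[m]$ and $\varphi\in\mathcal{S}_{X_{j'}}$, $I[j',\varphi]=(n,m,X'_1,\ldots,X'_m,\tau\varphi)$ with $X'_j=X_j$ for $j\le j'$ and $X'_j=X_j\varphi$ for $j>j'$; $I[0,\varphi]=I^\varphi$. A valid elementary transformation of $I$ is any $I[j,\varphi]$ with $j\in\{0,\ldots,m\}$,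 $\varphi\in\mathcal{S}_{X_j}$ (sets of the current instance). $I$ is nice if some instance of WPPSG$_0$ can be obtained from $I$ by a finite chain of valid elementary transformations. -}

module Defs where

open import Data.Nat using (ℕ; zero; suc; _<?_)
open import Data.Fin using (Fin; fromℕ<; _≤_)
open import Data.Fin.Subset using (Subset; _∈_; _∉_; ⊤)
open import Data.Fin.Permutation using (Permutation′; _⟨$⟩ʳ_; _⟨$⟩ˡ_; _∘ₚ_; flip; _≈_)
open import Data.Vec using (tabulate; lookup)
open import Data.Product using (Σ; _×_; ∃)
open import Relation.Nullary using (yes; no)
open import Relation.Binary.PropositionalEquality using (_≡_)
open import Relation.Binary.Construct.Closure.ReflexiveTransitive using (Star)

-- Permutations of [n] = Fin n.  i σ is  σ ⟨$⟩ʳ i ; the product π ∘ₚ σ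
-- is composed left to right: i (π ∘ₚ σ) = (i π) σ.

-- X σ = { i σ : i ∈ X }  (i ∈ X σ  iff  i σ⁻¹ ∈ X)
image : ∀ {n} → Subset n → Permutation′ n → Subset n
image X σ = tabulate (λ i → lookup X (σ ⟨$⟩ˡ i))

InSym : ∀ {n} → Subset n → Permutation′ n → Set
InSym X σ = ∀ i → i ∉ X → σ ⟨$⟩ʳ i ≡ i

Consecutive : ∀ {n} → Subset n → Set
Consecutive {n} X = ∀ (a b c : Fin n) → a ∈ X → c ∈ X → a ≤ b → b ≤ c → b ∈ X

-- X_j for j ∈ {0,…,m} with X_0 = [n]; (indices > m are never used)
Xat : ∀ {n m} → (Fin m → Subset n) → ℕ → Subset n
Xat X zero = ⊤
Xat {m = m} X (suc j) with j <? m
... | yes p = X (fromℕ< p)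
... | no _  = ⊤

mutual
  Π : ∀ {n m} → (Fin m → Subset n) → ℕ → Permutation′ n → Set
  Π X zero π = Data.Unit.⊤ where import Data.Unit
  Π X (suc j) π = Π′ X (suc j) π × Consecutive (image (Xat X (suc j)) π)

  Π′ : ∀ {n m} → (Fin m → Subset n) → ℕ → Permutation′ n → Set
  Π′ X zero π = Data.Empty.⊥ where import Data.Empty
  Π′ X (suc j) π =
    Σ (Permutation′ _) λ π₀ → Σ (Permutation′ _) λ σ →
      Π X j π₀ × InSym (image (Xat X j) π₀) σ × (π ≈ (π₀ ∘ₚ σ))

record Instance (n m : ℕ) : Set where
  constructor inst
  field
    X : Fin m → Subset n
    τ : Permutation′ n

conj : ∀ {n m} → Instance n m → Permutation′ n → Instance n m
conj (inst X τ) π = inst (λ j → image (X j) π) (flip π ∘ₚ τ ∘ₚ π)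

-- I[j', φ] for j' ∈ [m] (j' given as an element of Fin m, i.e. j' = toℕ j' + 1)
transform : ∀ {n m} → Instance n m → Fin m → Permutation′ n → Instance n m
transform (inst X τ) j′ φ =
  inst (λ j → Xnew j) (τ ∘ₚ φ)
  where
  open import Data.Fin using (_≤?_)
  Xnew : _ → _
  Xnew j with j ≤? j′
  ... | yes _ = X j
  ... | no _  = image (X j) φ

data Step {n m : ℕ} : Instance n m → Instance n m → Set where
  step₀ : ∀ I (φ : Permutation′ n) → Step I (conj I φ)
  stepⱼ : ∀ I (j : Fin m) (φ : Permutation′ n) →
          InSym (Instance.X I j) φ → Step I (transform I j φ)

InWPPSG₀ : ∀ {n m} → Instance n m → Set
InWPPSG₀ I = ∀ j → Consecutive (Instance.X I j)

Nice : ∀ {n m} → Instance n m → Set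
Nice I = ∃ λ I′ → Star Step I I′ × InWPPSG₀ I′

-- Both directions rest on one observation: every valid elementary transformation acts at
-- some stage s ∈ {0,…,m} by a permutation φ ∈ 𝒮_{X_s} of the current instance, fixing
-- the sets X_1,…,X_s and moving X_{s+1},…,X_m by φ.
-- (⇒) Along any chain of transformations from I the current sets are X_j ρ_j for a
-- sequence ρ_0, ρ_1, … with ρ_j⁻¹ ρ_{j+1} ∈ 𝒮_{X_j ρ_j}; a step at stage s multiplies
-- ρ_{s+1}, ρ_{s+2}, … by φ on the right, which keeps this invariant. If the chain ends in
-- WPPSG₀, the X_j ρ_j are consecutive, i.e. ρ_j ∈ Π_j for every j.
-- (⇐) Conversely, for π = π₀ σ ∈ Π_{j+1} with π₀ ∈ Π_j, an instance whose sets from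
-- stage j on are X_i π₀ and which is consecutive up to stage j is turned by the step at
-- stage j with σ into one whose sets from stage j+1 on are X_i π, consecutive up to j+1.

module Submission where

open import Defs
open import Data.Nat using (ℕ)
open import Data.Fin using (Fin)
open import Data.Fin.Subset using (Subset)
open import Data.Fin.Permutation using (Permutation′)
open import Data.Product using (∃)
open import Function.Bundles using (_⇔_)

open import Data.Nat as ℕ using (zero; suc; _<?_; z≤n; s≤s⁻¹; s<s⁻¹)
open import Data.Nat.Properties using (≤-refl; <⇒≤; <⇒≱; n<1+n; <-cmp; ≤-<-connex; m≤n⇒m<n∨m≡n)
open import Data.Fin as F using (toℕ; fromℕ<)
open import Data.Fin.Properties using (toℕ<n; fromℕ<-toℕ; toℕ-fromℕ<)
open import Data.Fin.Subset using (_∈_; _∉_; inside; ⊤)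
open import Data.Fin.Subset.Properties using (∈⊤)
open import Data.Fin.Permutation using (_⟨$⟩ʳ_; _⟨$⟩ˡ_; _∘ₚ_; flip; _≈_; id; inverseˡ; inverseʳ)
open import Data.Vec using (lookup)
open import Data.Vec.Properties
  using (tabulate-cong; lookup∘tabulate; tabulate∘lookup; []=⇒lookup; lookup⇒[]=; lookup-replicate)
open import Data.Product using (_×_; _,_; proj₁; proj₂)
open import Data.Sum using (inj₁; inj₂)
open import Data.Unit using (tt)
open import Relation.Binary using (tri<; tri≈; tri>)
open import Relation.Binary.PropositionalEquality using (_≡_; refl; sym; trans; cong; subst; module ≡-Reasoning)
open import Relation.Binary.Construct.Closure.ReflexiveTransitive using (Star; ε; _◅_; _◅◅_)
open import Relation.Nullary using (yes; no; ¬_; contradiction)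
open import Function.Bundles using (mk⇔)

open ≡-Reasoning

module _ {n : ℕ} where

  ∈-image⁺ : {Y : Subset n} (π : Permutation′ n) {i : Fin n} → π ⟨$⟩ˡ i ∈ Y → i ∈ image Y π
  ∈-image⁺ {Y} π {i} h = lookup⇒[]= i (image Y π) (trans (lookup∘tabulate _ i) ([]=⇒lookup h))

  ∈-image⁻ : {Y : Subset n} (π : Permutation′ n) {i : Fin n} → i ∈ image Y π → π ⟨$⟩ˡ i ∈ Y
  ∈-image⁻ {Y} π {i} h = lookup⇒[]= (π ⟨$⟩ˡ i) Y (trans (sym (lookup∘tabulate _ i)) ([]=⇒lookup h))

  ∉-image : {Y : Subset n} (π : Permutation′ n) {k : Fin n} → k ∉ Y → π ⟨$⟩ʳ k ∉ image Y π
  ∉-image {Y} π k∉Y h = k∉Y (subst (_∈ Y) (inverseˡ π) (∈-image⁻ π h))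

  ≈⇒⟨$⟩ˡ-≡ : {π π′ : Permutation′ n} → π ≈ π′ → ∀ i → π ⟨$⟩ˡ i ≡ π′ ⟨$⟩ˡ i
  ≈⇒⟨$⟩ˡ-≡ {π} {π′} π≈π′ i = begin
    π ⟨$⟩ˡ i                        ≡⟨ inverseˡ π′ ⟨
    π′ ⟨$⟩ˡ (π′ ⟨$⟩ʳ (π ⟨$⟩ˡ i))  ≡⟨ cong (π′ ⟨$⟩ˡ_) (π≈π′ (π ⟨$⟩ˡ i)) ⟨
    π′ ⟨$⟩ˡ (π ⟨$⟩ʳ (π ⟨$⟩ˡ i))   ≡⟨ cong (π′ ⟨$⟩ˡ_) (inverseʳ π) ⟩
    π′ ⟨$⟩ˡ i                       ∎

  image-cong : (Y : Subset n) {π π′ : Permutation′ n} → π ≈ π′ → image Y π ≡ image Y π′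
  image-cong Y {π} {π′} π≈π′ = tabulate-cong (λ i → cong (lookup Y) (≈⇒⟨$⟩ˡ-≡ {π} {π′} π≈π′ i))

  image-∘ : (Y : Subset n) (π φ : Permutation′ n) → image (image Y π) φ ≡ image Y (π ∘ₚ φ)
  image-∘ Y π φ = tabulate-cong (λ i → lookup∘tabulate _ (φ ⟨$⟩ˡ i))

  image-id : (Y : Subset n) → image Y id ≡ Y
  image-id = tabulate∘lookup

  image-⊤ : (π : Permutation′ n) → image ⊤ π ≡ ⊤
  image-⊤ π = trans
    (tabulate-cong (λ i → trans (lookup-replicate (π ⟨$⟩ˡ i) inside) (sym (lookup-replicate i inside))))
    (tabulate∘lookup ⊤)

  consecutive-⊤ : Consecutive {n} ⊤
  consecutive-⊤ _ _ _ _ _ _ _ = ∈⊤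

module _ {n m : ℕ} where

  Xat-All : (P : Subset n → Set) → P ⊤ → (X : Fin m → Subset n) → (∀ t → P (X t)) →
            ∀ j → P (Xat X j)
  Xat-All P P⊤ X PX zero = P⊤
  Xat-All P P⊤ X PX (suc j) with j <? m
  ... | yes p = PX (fromℕ< p)
  ... | no _  = P⊤

  Xat-natural : (f : Subset n → Subset n) → f ⊤ ≡ ⊤ → (X Y : Fin m → Subset n) →
                ∀ j → (∀ t → suc (toℕ t) ≡ j → X t ≡ f (Y t)) → Xat X j ≡ f (Xat Y j)
  Xat-natural f f⊤ X Y zero    _ = sym f⊤
  Xat-natural f f⊤ X Y (suc j) X≡fY with j <? m
  ... | yes p = X≡fY (fromℕ< p) (cong suc (toℕ-fromℕ< p))
  ... | no _  = sym f⊤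

  Xat-toℕ : (X : Fin m → Subset n) (t : Fin m) → Xat X (suc (toℕ t)) ≡ X t
  Xat-toℕ X t with toℕ t <? m
  ... | yes p = cong X (fromℕ<-toℕ t p)
  ... | no ¬p = contradiction (toℕ<n t) ¬p

  Xat-fromℕ< : (X : Fin m → Subset n) {j : ℕ} (p : j ℕ.< m) → Xat X (suc j) ≡ X (fromℕ< p)
  Xat-fromℕ< X {j} p with j <? m
  ... | yes _ = refl
  ... | no ¬p = contradiction p ¬p

  stages : Instance n m → ℕ → Subset n
  stages I = Xat (Instance.X I)

  transform-X-≤ : ∀ (I : Instance n m) t₀ φ t → t F.≤ t₀ →
                  Instance.X (transform I t₀ φ) t ≡ Instance.X I t
  transform-X-≤ I t₀ φ t t≤t₀ with t F.≤? t₀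
  ... | yes _ = refl
  ... | no t≰t₀ = contradiction t≤t₀ t≰t₀

  transform-X-> : ∀ (I : Instance n m) t₀ φ t → ¬ t F.≤ t₀ →
                  Instance.X (transform I t₀ φ) t ≡ image (Instance.X I t) φ
  transform-X-> I t₀ φ t t≰t₀ with t F.≤? t₀
  ... | yes t≤t₀ = contradiction t≤t₀ t≰t₀
  ... | no _     = refl

  record Shifted (s : ℕ) (φ : Permutation′ n) (I J : Instance n m) : Set where
    field
      upto  : ∀ j → j ℕ.≤ s → stages J j ≡ stages I j
      after : ∀ j → s ℕ.< j → stages J j ≡ image (stages I j) φ

  conj-shifted : ∀ (I : Instance n m) φ → Shifted 0 φ I (conj I φ)
  conj-shifted I φ = record
    { upto  = λ { .zero z≤n → refl }
    ; after = λ j _ → Xat-natural (λ Y → image Y φ) (image-⊤ φ) _ _ j (λ _ _ → refl)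
    }

  transform-shifted : ∀ (I : Instance n m) t₀ φ → Shifted (suc (toℕ t₀)) φ I (transform I t₀ φ)
  transform-shifted I t₀ φ = record
    { upto  = λ j j≤s → Xat-natural (λ Y → Y) refl _ _ j
                (λ { t refl → transform-X-≤ I t₀ φ t (s≤s⁻¹ j≤s) })
    ; after = λ j s<j → Xat-natural (λ Y → image Y φ) (image-⊤ φ) _ _ j
                (λ { t refl → transform-X-> I t₀ φ t (<⇒≱ (s<s⁻¹ s<j)) })
    }

  Step⇒shifted : ∀ {I J : Instance n m} → Step I J →
                 ∃ λ s → ∃ λ φ → InSym (stages I s) φ × Shifted s φ I J
  Step⇒shifted (step₀ I φ) = 0 , φ , (λ i i∉⊤ → contradiction ∈⊤ i∉⊤) , conj-shifted I φ
  Step⇒shifted (stepⱼ I t φ φ∈𝒮) =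
    suc (toℕ t) , φ , subst (λ Y → InSym Y φ) (sym (Xat-toℕ _ t)) φ∈𝒮 , transform-shifted I t φ

  shifted⇒Step : ∀ (I : Instance n m) s {φ} → s ℕ.≤ m → InSym (stages I s) φ →
                 ∃ λ J → Step I J × Shifted s φ I J
  shifted⇒Step I zero    {φ} _   _   = conj I φ , step₀ I φ , conj-shifted I φ
  shifted⇒Step I (suc j) {φ} j<m φ∈𝒮 =
    transform I t φ ,
    stepⱼ I t φ (subst (λ Y → InSym Y φ) (Xat-fromℕ< _ j<m) φ∈𝒮) ,
    subst (λ s → Shifted s φ I (transform I t φ)) (cong suc (toℕ-fromℕ< j<m)) (transform-shifted I t φ)
    where
    t : Fin m
    t = fromℕ< j<m

module _ {n m : ℕ} (X : Fin m → Subset n) where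

  -- ρ_j⁻¹ ρ_{j+1} ∈ 𝒮_{X_j ρ_j}
  Coherent : (ℕ → Permutation′ n) → Set
  Coherent ρ = ∀ j k → k ∉ Xat X j → ρ (suc j) ⟨$⟩ʳ k ≡ ρ j ⟨$⟩ʳ k

  record Labelling (I : Instance n m) : Set where
    field
      ρ        : ℕ → Permutation′ n
      coherent : Coherent ρ
      realises : ∀ j → stages I j ≡ image (Xat X j) (ρ j)

  labelling-start : (τ : Permutation′ n) → Labelling (inst X τ)
  labelling-start τ = record
    { ρ = λ _ → id ; coherent = λ _ _ _ → refl ; realises = λ j → sym (image-id (Xat X j)) }

  relabelAfter : ℕ → Permutation′ n → (ℕ → Permutation′ n) → ℕ → Permutation′ n
  relabelAfter s φ ρ j with j ℕ.≤? s
  ... | yes _ = ρ j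
  ... | no _  = ρ j ∘ₚ φ

  relabelAfter-≤ : ∀ s φ ρ {j} → j ℕ.≤ s → relabelAfter s φ ρ j ≡ ρ j
  relabelAfter-≤ s φ ρ {j} j≤s with j ℕ.≤? s
  ... | yes _   = refl
  ... | no j≰s  = contradiction j≤s j≰s

  relabelAfter-> : ∀ s φ ρ {j} → s ℕ.< j → relabelAfter s φ ρ j ≡ ρ j ∘ₚ φ
  relabelAfter-> s φ ρ {j} s<j with j ℕ.≤? s
  ... | yes j≤s = contradiction j≤s (<⇒≱ s<j)
  ... | no _    = refl

  relabelAfter-coherent : ∀ {s φ ρ} → Coherent ρ → InSym (image (Xat X s) (ρ s)) φ →
                          Coherent (relabelAfter s φ ρ)
  relabelAfter-coherent {s} {φ} {ρ} coh φ∈𝒮 j k k∉ with <-cmp j s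
  ... | tri< j<s _ _ = begin
    relabelAfter s φ ρ (suc j) ⟨$⟩ʳ k  ≡⟨ cong (_⟨$⟩ʳ k) (relabelAfter-≤ s φ ρ j<s) ⟩
    ρ (suc j) ⟨$⟩ʳ k                   ≡⟨ coh j k k∉ ⟩
    ρ j ⟨$⟩ʳ k                         ≡⟨ cong (_⟨$⟩ʳ k) (relabelAfter-≤ s φ ρ (<⇒≤ j<s)) ⟨
    relabelAfter s φ ρ j ⟨$⟩ʳ k        ∎
  ... | tri≈ _ refl _ = begin
    relabelAfter s φ ρ (suc s) ⟨$⟩ʳ k  ≡⟨ cong (_⟨$⟩ʳ k) (relabelAfter-> s φ ρ (n<1+n s)) ⟩
    φ ⟨$⟩ʳ (ρ (suc s) ⟨$⟩ʳ k)          ≡⟨ cong (φ ⟨$⟩ʳ_) (coh s k k∉) ⟩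
    φ ⟨$⟩ʳ (ρ s ⟨$⟩ʳ k)                ≡⟨ φ∈𝒮 (ρ s ⟨$⟩ʳ k) (∉-image (ρ s) k∉) ⟩
    ρ s ⟨$⟩ʳ k                         ≡⟨ cong (_⟨$⟩ʳ k) (relabelAfter-≤ s φ ρ ≤-refl) ⟨
    relabelAfter s φ ρ s ⟨$⟩ʳ k        ∎
  ... | tri> _ _ s<j = begin
    relabelAfter s φ ρ (suc j) ⟨$⟩ʳ k  ≡⟨ cong (_⟨$⟩ʳ k) (relabelAfter-> s φ ρ (ℕ.s≤s (<⇒≤ s<j))) ⟩
    φ ⟨$⟩ʳ (ρ (suc j) ⟨$⟩ʳ k)          ≡⟨ cong (φ ⟨$⟩ʳ_) (coh j k k∉) ⟩
    φ ⟨$⟩ʳ (ρ j ⟨$⟩ʳ k)                ≡⟨ cong (_⟨$⟩ʳ k) (relabelAfter-> s φ ρ s<j) ⟨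
    relabelAfter s φ ρ j ⟨$⟩ʳ k        ∎

  relabelAfter-realises : ∀ {s φ ρ} {I J : Instance n m} → (∀ j → stages I j ≡ image (Xat X j) (ρ j)) →
                          Shifted s φ I J → ∀ j → stages J j ≡ image (Xat X j) (relabelAfter s φ ρ j)
  relabelAfter-realises {s} {φ} {ρ} {I} {J} realises shifted j with ≤-<-connex j s
  ... | inj₁ j≤s = begin
    stages J j                          ≡⟨ Shifted.upto shifted j j≤s ⟩
    stages I j                          ≡⟨ realises j ⟩
    image (Xat X j) (ρ j)               ≡⟨ cong (image (Xat X j)) (relabelAfter-≤ s φ ρ j≤s) ⟨
    image (Xat X j) (relabelAfter s φ ρ j) ∎
  ... | inj₂ s<j = begin
    stages J j                          ≡⟨ Shifted.after shifted j s<j ⟩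
    image (stages I j) φ                ≡⟨ cong (λ Y → image Y φ) (realises j) ⟩
    image (image (Xat X j) (ρ j)) φ     ≡⟨ image-∘ (Xat X j) (ρ j) φ ⟩
    image (Xat X j) (ρ j ∘ₚ φ)          ≡⟨ cong (image (Xat X j)) (relabelAfter-> s φ ρ s<j) ⟨
    image (Xat X j) (relabelAfter s φ ρ j) ∎

  labelling-Step : ∀ {I J : Instance n m} → Step I J → Labelling I → Labelling J
  labelling-Step step L with Step⇒shifted step
  ... | s , φ , φ∈𝒮 , shifted = record
    { ρ        = relabelAfter s φ ρ
    ; coherent = relabelAfter-coherent coherent (subst (λ Y → InSym Y φ) (realises s) φ∈𝒮)
    ; realises = relabelAfter-realises realises shifted
    }
    where open Labelling L

  labelling-Star : ∀ {I J : Instance n m} → Star Step I J → Labelling I → Labelling J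
  labelling-Star ε           L = L
  labelling-Star (step ◅ st) L = labelling-Star st (labelling-Step step L)

  labelling⇒Π : ∀ {J : Instance n m} (L : Labelling J) → (∀ j → Consecutive (stages J j)) →
                ∀ j → Π X j (Labelling.ρ L j)
  labelling⇒Π L consecutive zero    = tt
  labelling⇒Π L consecutive (suc j) =
    (ρ j , flip (ρ j) ∘ₚ ρ (suc j) , labelling⇒Π L consecutive j , quotient∈𝒮 , factorisation) ,
    subst Consecutive (realises (suc j)) (consecutive (suc j))
    where
    open Labelling L
    quotient∈𝒮 : InSym (image (Xat X j) (ρ j)) (flip (ρ j) ∘ₚ ρ (suc j))
    quotient∈𝒮 i i∉ = trans (coherent j (ρ j ⟨$⟩ˡ i) (λ h → i∉ (∈-image⁺ (ρ j) h))) (inverseʳ (ρ j))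
    factorisation : ρ (suc j) ≈ ρ j ∘ₚ flip (ρ j) ∘ₚ ρ (suc j)
    factorisation i = cong (ρ (suc j) ⟨$⟩ʳ_) (sym (inverseˡ (ρ j)))

  record ReducedUpTo (τ : Permutation′ n) (j : ℕ) (π : Permutation′ n) : Set where
    field
      J           : Instance n m
      reachable   : Star Step (inst X τ) J
      agrees      : ∀ i → j ℕ.≤ i → stages J i ≡ image (Xat X i) π
      consecutive : ∀ i → i ℕ.≤ j → Consecutive (stages J i)

  reducedUpTo-zero : ∀ τ π → ReducedUpTo τ 0 π
  reducedUpTo-zero τ π = record
    { J           = conj (inst X τ) π
    ; reachable   = step₀ (inst X τ) π ◅ ε
    ; agrees      = agrees
    ; consecutive = λ { .zero z≤n → consecutive-⊤ }
    }
    where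
    agrees : ∀ i → 0 ℕ.≤ i → stages (conj (inst X τ) π) i ≡ image (Xat X i) π
    agrees zero    _ = sym (image-⊤ π)
    agrees (suc i) _ = Shifted.after (conj-shifted (inst X τ) π) (suc i) (ℕ.s≤s z≤n)

  reducedUpTo-suc : ∀ {τ j π₀ σ π} → ReducedUpTo τ j π₀ → j ℕ.< m →
                    InSym (image (Xat X j) π₀) σ → π ≈ π₀ ∘ₚ σ →
                    Consecutive (image (Xat X (suc j)) π) → ReducedUpTo τ (suc j) π
  reducedUpTo-suc {τ} {j} {π₀} {σ} {π} R j<m σ∈𝒮 π≈π₀σ consecutive-π = record
    { J           = J′
    ; reachable   = reachable ◅◅ (step ◅ ε)
    ; agrees      = agrees′
    ; consecutive = consecutive′
    }
    where
    open ReducedUpTo R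
    next : ∃ λ J′ → Step J J′ × Shifted j σ J J′
    next = shifted⇒Step J j (<⇒≤ j<m) (subst (λ Y → InSym Y σ) (sym (agrees j ≤-refl)) σ∈𝒮)
    J′ : Instance n m
    J′ = proj₁ next
    step : Step J J′
    step = proj₁ (proj₂ next)
    shifted : Shifted j σ J J′
    shifted = proj₂ (proj₂ next)
    agrees′ : ∀ i → suc j ℕ.≤ i → stages J′ i ≡ image (Xat X i) π
    agrees′ i j<i = begin
      stages J′ i                       ≡⟨ Shifted.after shifted i j<i ⟩
      image (stages J i) σ              ≡⟨ cong (λ Y → image Y σ) (agrees i (<⇒≤ j<i)) ⟩
      image (image (Xat X i) π₀) σ      ≡⟨ image-∘ (Xat X i) π₀ σ ⟩
      image (Xat X i) (π₀ ∘ₚ σ)         ≡⟨ image-cong (Xat X i) {π} {π₀ ∘ₚ σ} π≈π₀σ ⟨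
      image (Xat X i) π                 ∎
    consecutive′ : ∀ i → i ℕ.≤ suc j → Consecutive (stages J′ i)
    consecutive′ i i≤1+j with m≤n⇒m<n∨m≡n i≤1+j
    ... | inj₁ i<1+j = subst Consecutive (sym (Shifted.upto shifted i (s≤s⁻¹ i<1+j)))
                             (consecutive i (s≤s⁻¹ i<1+j))
    ... | inj₂ refl  = subst Consecutive (sym (agrees′ (suc j) ≤-refl)) consecutive-π

  Π⇒reducedUpTo : ∀ τ j {π} → j ℕ.≤ m → Π X j π → ReducedUpTo τ j π
  Π⇒reducedUpTo τ zero    {π} _   _ = reducedUpTo-zero τ π
  Π⇒reducedUpTo τ (suc j) {π} j<m ((π₀ , σ , π₀∈Π , σ∈𝒮 , π≈π₀σ) , consecutive-π) =
    reducedUpTo-suc {σ = σ} {π} (Π⇒reducedUpTo τ j (<⇒≤ j<m) π₀∈Π) j<m σ∈𝒮 π≈π₀σ consecutive-π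

theorem5p5 : (n m : ℕ) (X : Fin m → Subset n) (τ : Permutation′ n) →
             Nice (inst X τ) ⇔ (∃ λ π → Π X m π)
theorem5p5 n m X τ = mk⇔ nice⇒Π Π⇒nice
  where
  nice⇒Π : Nice (inst X τ) → ∃ λ π → Π X m π
  nice⇒Π (J , reach , J∈WPPSG₀) =
    Labelling.ρ L m , labelling⇒Π X L (Xat-All Consecutive consecutive-⊤ _ J∈WPPSG₀) m
    where L = labelling-Star X reach (labelling-start X τ)

  Π⇒nice : (∃ λ π → Π X m π) → Nice (inst X τ)
  Π⇒nice (π , π∈Π) =
    J , reachable , λ t → subst Consecutive (Xat-toℕ _ t) (consecutive (suc (toℕ t)) (toℕ<n t))
    where open ReducedUpTo (Π⇒reducedUpTo X τ m ≤-refl π∈Π)
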